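{- Let $k\geq 2$ and let $G$ be a finite CI-group. If $G$ has the $k$-if property, then every nontrivial characteristic subgroup $H$ of $G$ also has the $k$-if property.
   Context: For a finite group $X$ let $X^*=X\setminus\{1\}$. For an inverse-closed subset $S\subseteq X^*$, the Cayley graph $\mathrm{Cay}(X,S)$ has vertex set $X$ and edges $\{h,g\}$ with $gh^{ -1}\in S$. $X$ is a CI-group if for all inverse-closed $S,T\subseteq X^*$, $\mathrm{Cay}(X,S)\cong\mathrm{Cay}(X,T)$ implies $T=S^{\alpha}$ for some $\alpha\in\mathrm{Aut}(X)$. A partition of a set is a collection of non-empty pairwise disjoint subsets whose union is the set. For $k\geq2$, $\mathrm{Cay}(X,S)$ is a $k$-if Cayley graph if there is a partition $\{S_0=S,\dots,S_{k-1}\}$ of $X^*$ into inverse-closed subsets with $\mathrm{Cay}(X,S_i)\cong\mathrm{Cay}(X,S)$ for all $i$; $X$ has the $k$-if property if some $\mathrm{Cay}(X,S)$ is a $k$-if Cayley graph. A characteristic subgroup of $G$ is a subgroup fixed by every automorphism of $G$. -}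

module Defs where

open import Data.Bool using (Bool; true; false)
open import Data.Fin using (Fin)
open import Data.Nat using (ℕ)
open import Data.Product using (Σ; Σ-syntax; ∃; ∃-syntax; _×_; _,_; proj₁; proj₂)
open import Function.Bundles using (_↔_; Inverse)
open import Relation.Binary.PropositionalEquality
  using (_≡_; _≢_; refl; cong; cong₂; sym; trans; subst)
open import Algebra.Structures using (IsGroup; IsMonoid; IsSemigroup; IsMagma)
open import Relation.Binary.PropositionalEquality.Properties using () renaming (isEquivalence to ≡-isEquivalence)

Bool-≡-irrelevant : {a b : Bool} (p q : a ≡ b) → p ≡ q
Bool-≡-irrelevant {false} refl refl = refl
Bool-≡-irrelevant {true} refl refl = refl

record Grp : Set₁ where
  field
    Carrier : Set
    _∙_     : Carrier → Carrier → Carrier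
    ε       : Carrier
    _⁻¹     : Carrier → Carrier
    isGroup : IsGroup _≡_ _∙_ ε _⁻¹

Finite : Grp → Set
Finite X = Σ[ n ∈ ℕ ] (Fin n ↔ Grp.Carrier X)

module _ (X : Grp) where
  open Grp X

  Subset : Set
  Subset = Carrier → Bool

  ⊆X* : Subset → Set
  ⊆X* S = S ε ≡ false

  InverseClosed : Subset → Set
  InverseClosed S = ∀ x → S (x ⁻¹) ≡ S x

  -- Cay(X,S): vertices X, edge {h,g} iff g h⁻¹ ∈ S.
  -- A graph isomorphism Cay(X,S) ≅ Cay(X,T): a bijection of the vertex
  -- set preserving adjacency and non-adjacency.
  CayIso : Subset → Subset → Set
  CayIso S T = Σ[ f ∈ Carrier ↔ Carrier ]
    (∀ h g → T (Inverse.to f g ∙ (Inverse.to f h ⁻¹)) ≡ S (g ∙ (h ⁻¹)))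

  IsAut : (Carrier ↔ Carrier) → Set
  IsAut α = ∀ x y → Inverse.to α (x ∙ y) ≡ Inverse.to α x ∙ Inverse.to α y

  IsImage : Subset → (Carrier ↔ Carrier) → Subset → Set
  IsImage S α T = ∀ x → T (Inverse.to α x) ≡ S x

  IsCIGroup : Set
  IsCIGroup = ∀ (S T : Subset) →
    ⊆X* S → InverseClosed S → ⊆X* T → InverseClosed T →
    CayIso S T → Σ[ α ∈ Carrier ↔ Carrier ] (IsAut α × IsImage S α T)

  IsKIf : (k : ℕ) → Subset → Set
  IsKIf k S = Σ[ Sᵢ ∈ (Fin k → Subset) ]
      (∃[ i₀ ] ∀ x → Sᵢ i₀ x ≡ S x)
    × ((i : Fin k) → ⊆X* (Sᵢ i))
    × ((i : Fin k) → ∃[ x ] Sᵢ i x ≡ true)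
    × ((i j : Fin k) (x : Carrier) → Sᵢ i x ≡ true → Sᵢ j x ≡ true → i ≡ j)
    × ((x : Carrier) → x ≢ ε → ∃[ i ] Sᵢ i x ≡ true)
    × ((i : Fin k) → InverseClosed (Sᵢ i))
    × ((i : Fin k) → CayIso S (Sᵢ i))

  HasKIfProperty : ℕ → Set
  HasKIfProperty k = Σ[ S ∈ Subset ] IsKIf k S

  IsSubgroup : Subset → Set
  IsSubgroup H = (H ε ≡ true)
    × (∀ x y → H x ≡ true → H y ≡ true → H (x ∙ y) ≡ true)
    × (∀ x → H x ≡ true → H (x ⁻¹) ≡ true)

  IsCharacteristic : Subset → Set
  IsCharacteristic H = ∀ (α : Carrier ↔ Carrier) → IsAut α →
    ∀ x → H (Inverse.to α x) ≡ H x

  Nontrivial : Subset → Set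
  Nontrivial H = ∃[ x ] (H x ≡ true × x ≢ ε)

  module _ (H : Subset) (sg : IsSubgroup H) where
    private
      open IsGroup (Grp.isGroup X) renaming (assoc to as; identityˡ to idl; identityʳ to idr; inverseˡ to invl; inverseʳ to invr)
      C : Set
      C = Σ[ x ∈ Carrier ] H x ≡ true
      mk : ∀ {a b : Carrier} {p : H a ≡ true} {q : H b ≡ true} → a ≡ b → _≡_ {A = C} (a , p) (b , q)
      mk {p = p} {q = q} refl = cong (_ ,_) (Bool-≡-irrelevant p q)
      _·_ : C → C → C
      (a , p) · (b , q) = (a ∙ b) , proj₁ (proj₂ sg) a b p q
      e : C
      e = ε , proj₁ sg
      inv : C → C
      inv (a , p) = (a ⁻¹) , proj₂ (proj₂ sg) a p
      isG : IsGroup _≡_ _·_ e inv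
      isG = record
        { isMonoid = record
          { isSemigroup = record
            { isMagma = record { isEquivalence = ≡-isEquivalence ; ∙-cong = cong₂ _·_ }
            ; assoc = λ { (a , _) (b , _) (c , _) → mk (as a b c) } }
          ; identity = (λ { (a , _) → mk (idl a) }) , (λ { (a , _) → mk (idr a) }) }
        ; inverse = (λ { (a , _) → mk (invl a) }) , (λ { (a , _) → mk (invr a) })
        ; ⁻¹-cong = cong inv }

    SubGrp : Grp
    SubGrp = record { Carrier = C ; _∙_ = _·_ ; ε = e ; _⁻¹ = inv ; isGroup = isG }

{-# OPTIONS --safe #-}
module Submission where

-- In a CI-group every part Sᵢ of a k-if partition is an automorphic image Sᵢ = S^αᵢ,
-- and a characteristic subgroup H is mapped onto itself by each αᵢ. Intersecting
-- with H therefore turns the partition of G* into a partition of H* whose parts are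
-- the images (S ∩ H)^(αᵢ|H), so the Cayley graphs on H are again isomorphic. The
-- parts stay non-empty because some Sⱼ meets H*, hence so does S = Sⱼ^(αⱼ⁻¹) and
-- with it every Sᵢ.

open import Defs
open import Data.Nat using (ℕ; _≥_)
open import Data.Bool using (true)
open import Data.Fin using (Fin)
open import Data.Product using (Σ-syntax; ∃-syntax; _,_; _×_; proj₁)
open import Function.Bundles using (_↔_; Inverse; mk↔ₛ′)
open import Relation.Binary.PropositionalEquality
open import Algebra.Bundles using (Group)
import Algebra.Properties.Group as GroupProperties

open Inverse using (to; from; strictlyInverseˡ; strictlyInverseʳ)

module _ (X : Grp) where
  open Grp X

  Inhabited : Subset X → Set
  Inhabited S = ∃[ x ] S x ≡ true

  AutImage : Subset X → Subset X → Set
  AutImage S T = Σ[ α ∈ Carrier ↔ Carrier ] (IsAut X α × IsImage X S α T)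

  private
    group : Group _ _
    group = record { isGroup = isGroup }

  module _ (α : Carrier ↔ Carrier) (α-hom : IsAut X α) where
    open GroupProperties group using (identityˡ-unique; inverseˡ-unique)
    open Group group using (identityʳ; inverseˡ)

    IsAut⇒ε : to α ε ≡ ε
    IsAut⇒ε = identityˡ-unique (to α ε) (to α ε)
      (trans (sym (α-hom ε ε)) (cong (to α) (identityʳ ε)))

    IsAut⇒⁻¹ : ∀ x → to α (x ⁻¹) ≡ (to α x) ⁻¹
    IsAut⇒⁻¹ x = inverseˡ-unique (to α (x ⁻¹)) (to α x)
      (trans (sym (α-hom (x ⁻¹) x)) (trans (cong (to α) (inverseˡ x)) IsAut⇒ε))

  AutImage⇒CayIso : ∀ {S T} → AutImage S T → CayIso X S T
  AutImage⇒CayIso {S} {T} (α , α-hom , S^α≡T) = α , λ h g → begin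
    T (to α g ∙ (to α h ⁻¹))    ≡⟨ cong (λ y → T (to α g ∙ y)) (IsAut⇒⁻¹ α α-hom h) ⟨
    T (to α g ∙ to α (h ⁻¹))    ≡⟨ cong T (α-hom g (h ⁻¹)) ⟨
    T (to α (g ∙ (h ⁻¹)))       ≡⟨ S^α≡T (g ∙ (h ⁻¹)) ⟩
    S (g ∙ (h ⁻¹))              ∎
    where open ≡-Reasoning

  AutImage-inhabited : ∀ {S T} → AutImage S T → Inhabited S → Inhabited T
  AutImage-inhabited (α , _ , S^α≡T) (x , x∈S) = to α x , trans (S^α≡T x) x∈S

  AutImage-inhabited⁻ : ∀ {S T} → AutImage S T → Inhabited T → Inhabited S
  AutImage-inhabited⁻ {S} {T} (α , _ , S^α≡T) (y , y∈T) = from α y , (begin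
    S (from α y)         ≡⟨ S^α≡T (from α y) ⟨
    T (to α (from α y))  ≡⟨ cong T (strictlyInverseˡ α y) ⟩
    T y                  ≡⟨ y∈T ⟩
    true                 ∎)
    where open ≡-Reasoning

  IsKIf⇒AutImages : IsCIGroup X → ∀ {k S} (kif : IsKIf X k S) →
    (i : Fin k) → AutImage S (proj₁ kif i)
  IsKIf⇒AutImages ci {S = S} (Sᵢ , (i₀ , Sᵢ₀≡S) , Sᵢ⊆X* , _ , _ , _ , Sᵢ-inv , Sᵢ≅S) i =
    ci S (Sᵢ i) S⊆X* S-inv (Sᵢ⊆X* i) (Sᵢ-inv i) (Sᵢ≅S i)
    where
      S⊆X* : ⊆X* X S
      S⊆X* = trans (sym (Sᵢ₀≡S ε)) (Sᵢ⊆X* i₀)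

      S-inv : InverseClosed X S
      S-inv x = trans (sym (Sᵢ₀≡S (x ⁻¹))) (trans (Sᵢ-inv i₀ x) (Sᵢ₀≡S x))

module Restriction (X : Grp) (H : Subset X) (sg : IsSubgroup X H) where
  open Grp X

  K : Grp
  K = SubGrp X H sg

  _∩H : Subset X → Subset K
  (S ∩H) (x , _) = S x

  ∩H-≡ : ∀ {x y} {x∈H : H x ≡ true} {y∈H : H y ≡ true} →
    x ≡ y → _≡_ {A = Grp.Carrier K} (x , x∈H) (y , y∈H)
  ∩H-≡ refl = cong (_ ,_) (Bool-≡-irrelevant _ _)

  PreservesH : Carrier ↔ Carrier → Set
  PreservesH α = ∀ x → H (to α x) ≡ H x

  restrict : (α : Carrier ↔ Carrier) → PreservesH α → Grp.Carrier K ↔ Grp.Carrier K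
  restrict α α-H = mk↔ₛ′
    (λ (x , x∈H) → to α x , trans (α-H x) x∈H)
    (λ (y , y∈H) → from α y , trans (from-H y) y∈H)
    (λ _ → ∩H-≡ (strictlyInverseˡ α _))
    (λ _ → ∩H-≡ (strictlyInverseʳ α _))
    where
      from-H : ∀ y → H (from α y) ≡ H y
      from-H y = trans (sym (α-H (from α y))) (cong H (strictlyInverseˡ α y))

  module _ (α : Carrier ↔ Carrier) (α-H : PreservesH α) where

    restrict-IsAut : IsAut X α → IsAut K (restrict α α-H)
    restrict-IsAut α-hom (x , _) (y , _) = ∩H-≡ (α-hom x y)

    restrict-IsImage : ∀ {S T} → IsImage X S α T → IsImage K (S ∩H) (restrict α α-H) (T ∩H)
    restrict-IsImage S^α≡T (x , _) = S^α≡T x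

  restrict-AutImage : IsCharacteristic X H → ∀ {S T} →
    AutImage X S T → AutImage K (S ∩H) (T ∩H)
  restrict-AutImage char {S} {T} (α , α-hom , S^α≡T) =
    restrict α α-H , restrict-IsAut α α-H α-hom , restrict-IsImage α α-H {S} {T} S^α≡T
    where
      α-H : PreservesH α
      α-H = char α α-hom

  IsKIf-∩H : ∀ {k S} → Nontrivial X H → (kif : IsKIf X k S) →
    ((i : Fin k) → AutImage K (S ∩H) (proj₁ kif i ∩H)) → IsKIf K k (S ∩H)
  IsKIf-∩H {k} {S} (x₀ , x₀∈H , x₀≢ε)
           (Sᵢ , (i₀ , Sᵢ₀≡S) , Sᵢ⊆X* , _ , disjoint , cover , Sᵢ-inv , _) images =
      (λ i → Sᵢ i ∩H)
    , (i₀ , λ (x , _) → Sᵢ₀≡S x)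
    , Sᵢ⊆X*
    , inhabited
    , (λ i j (x , _) → disjoint i j x)
    , cover-H*
    , (λ i (x , _) → Sᵢ-inv i x)
    , (λ i → AutImage⇒CayIso K {S ∩H} {Sᵢ i ∩H} (images i))
    where
      S∩H-inhabited : Inhabited K (S ∩H)
      S∩H-inhabited with cover x₀ x₀≢ε
      ... | j , x₀∈Sⱼ = AutImage-inhabited⁻ K (images j) ((x₀ , x₀∈H) , x₀∈Sⱼ)

      inhabited : (i : Fin k) → Inhabited K (Sᵢ i ∩H)
      inhabited i = AutImage-inhabited K (images i) S∩H-inhabited

      cover-H* : (x : Grp.Carrier K) → x ≢ Grp.ε K → ∃[ i ] (Sᵢ i ∩H) x ≡ true
      cover-H* (x , x∈H) x≢ε = cover x (λ x≡ε → x≢ε (∩H-≡ x≡ε))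

lemma2p5 : (k : ℕ) → k ≥ 2 → (G : Grp) → Finite G → IsCIGroup G →
    HasKIfProperty G k →
    (H : Subset G) (sg : IsSubgroup G H) → IsCharacteristic G H → Nontrivial G H →
    HasKIfProperty (SubGrp G H sg) k
lemma2p5 k _ G _ ci (S , kif) H sg char nontrivial =
  S ∩H , IsKIf-∩H nontrivial kif λ i →
    restrict-AutImage char {S} {proj₁ kif i} (IsKIf⇒AutImages G ci kif i)
  where open Restriction G H sg
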